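{- Let $r\geq 4$ and let $M_r$ be the matrix indexed by subsets of $[r]$ with $M_r(S,T)=\binom{|S\cap T|}{2}+\binom{|\overline{S}\cap\overline{T}|}{2}$, $\overline{S}=[r]\setminus S$. Then the eigenspace of $M_r$ associated with eigenvalue $2^{r-3}(r-2)$ has dimension at least $r-1$.
   Context: $[r]=\{1,\ldots,r\}$. -}

module Defs where

import Data.Nat as ℕ
open import Data.Nat using (ℕ; zero; suc; _∸_; _^_)
open import Data.Nat.Combinatorics using (_C_)
open import Data.Integer using (ℤ; +_; _+_; _*_; 0ℤ)
open import Data.Fin using (Fin)
open import Data.Fin.Subset using (Subset; ∁; _∩_; ∣_∣)
open import Data.Vec using ([]; _∷_)
open import Data.Bool using (true; false)
open import Relation.Binary.PropositionalEquality using (_≡_)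
open import Data.List using (List; []; _∷_; map; _++_; allFin; foldr)

allSubsets : (n : ℕ) → List (Subset n)
allSubsets zero = [] ∷ []
allSubsets (suc n) = map (false ∷_) (allSubsets n) ++ map (true ∷_) (allSubsets n)

sumℤ : List ℤ → ℤ
sumℤ = foldr _+_ 0ℤ

sumSubsets : (n : ℕ) → (Subset n → ℤ) → ℤ
sumSubsets n f = sumℤ (map f (allSubsets n))

sumFin : (k : ℕ) → (Fin k → ℤ) → ℤ
sumFin k f = sumℤ (map f (allFin k))

M : (r : ℕ) → Subset r → Subset r → ℤ
M r S T = + (∣ S ∩ T ∣ C 2) + + (∣ ∁ S ∩ ∁ T ∣ C 2)

Mmul : (r : ℕ) → (Subset r → ℤ) → Subset r → ℤ
Mmul r v S = sumSubsets r (λ T → M r S T * v T)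

eigval : ℕ → ℤ
eigval r = + (2 ^ (r ∸ 3) ℕ.* (r ∸ 2))

InEigenspace : (r : ℕ) → ℤ → (Subset r → ℤ) → Set
InEigenspace r λ' v = ∀ S → Mmul r v S ≡ λ' * v S

-- Linear independence of k integer vectors indexed by subsets of [r]
-- (over ℤ, equivalently over ℚ by clearing denominators).
LinIndep : (r k : ℕ) → (Fin k → Subset r → ℤ) → Set
LinIndep r k vs = (c : Fin k → ℤ) →
  (∀ S → sumFin k (λ i → c i * vs i S) ≡ 0ℤ) → ∀ i → c i ≡ 0ℤ

-- Let vᵢ(T) = [i ∈ T] − [i+1 ∈ T]. The entry M(S,T) depends on T only through the
-- agreement counts a = |S ∩ T| and b = |S̄ ∩ T̄|. Pairing each T with (tᵢ,tᵢ₊₁) = (1,0)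
-- with the T′ that has (0,1) and agrees with T elsewhere gives
--   (M vᵢ)(S) = (sᵢ − sᵢ₊₁) Σ_U [C(a+1,2) − C(a,2) + C(b+1,2) − C(b,2)] = (sᵢ − sᵢ₊₁) Σ_U (a + b),
-- U ranging over subsets of the other r − 2 coordinates and a + b counting the coordinates
-- on which U agrees with S. Each coordinate agrees for half of the U, so the last sum is
-- (r − 2) 2^(r−3). The vᵢ are independent because vₗ({1,…,i}) = [l = i].
module Submission where

open import Defs
open import Data.Nat using (ℕ; _≤_; _∸_; zero; suc; s≤s; _^_)
import Data.Nat as ℕ
import Data.Nat.Properties as ℕ
open import Data.Nat.Combinatorics using (_C_; nCk+nC[k+1]≡[n+1]C[k+1]; nC1≡n)
import Data.Nat.Tactic.RingSolver as ℕ-Solver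
open import Data.Integer using (ℤ; +_; _+_; _-_; _*_; 0ℤ)
import Data.Integer.Properties as ℤ
open import Data.Integer.Tactic.RingSolver using (solve-∀)
open import Algebra.Properties.CommutativeSemigroup ℤ.+-commutativeSemigroup using (interchange)
open import Data.Fin using (Fin; zero; suc)
open import Data.Fin.Subset using (Subset; ∁; _∩_; ∣_∣; ⊥)
open import Data.Vec using (Vec; _∷_; [])
open import Data.Bool using (Bool; true; false)
open import Data.List using (List; []; _∷_; map; _++_)
import Data.List.Properties as List
open import Data.Product using (Σ; _×_; _,_)
open import Function using (_∘_)
open import Relation.Binary.PropositionalEquality

sumℤ-++ : (xs ys : List ℤ) → sumℤ (xs ++ ys) ≡ sumℤ xs + sumℤ ys
sumℤ-++ []       ys = sym (ℤ.+-identityˡ _)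
sumℤ-++ (x ∷ xs) ys = trans (cong (_+_ x) (sumℤ-++ xs ys)) (sym (ℤ.+-assoc x _ _))

module _ {A : Set} where

  sumℤ-map-+ : (xs : List A) (f g : A → ℤ) →
               sumℤ (map (λ a → f a + g a) xs) ≡ sumℤ (map f xs) + sumℤ (map g xs)
  sumℤ-map-+ []       f g = refl
  sumℤ-map-+ (x ∷ xs) f g =
    trans (cong (_+_ (f x + g x)) (sumℤ-map-+ xs f g)) (interchange (f x) (g x) _ _)

  sumℤ-map-*ʳ : (xs : List A) (f : A → ℤ) (d : ℤ) →
                sumℤ (map (λ a → f a * d) xs) ≡ sumℤ (map f xs) * d
  sumℤ-map-*ʳ []       f d = sym (ℤ.*-zeroˡ d)
  sumℤ-map-*ʳ (x ∷ xs) f d =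
    trans (cong (_+_ (f x * d)) (sumℤ-map-*ʳ xs f d)) (sym (ℤ.*-distribʳ-+ d (f x) _))

sumSubsets-suc : ∀ n (f : Subset (suc n) → ℤ) →
                 sumSubsets (suc n) f ≡ sumSubsets n (f ∘ (false ∷_)) + sumSubsets n (f ∘ (true ∷_))
sumSubsets-suc n f = begin
  sumℤ (map f (map (false ∷_) Ss ++ map (true ∷_) Ss))
    ≡⟨ cong sumℤ (List.map-++ f (map (false ∷_) Ss) _) ⟩
  sumℤ (map f (map (false ∷_) Ss) ++ map f (map (true ∷_) Ss))
    ≡⟨ sumℤ-++ (map f (map (false ∷_) Ss)) _ ⟩
  sumℤ (map f (map (false ∷_) Ss)) + sumℤ (map f (map (true ∷_) Ss))
    ≡⟨ sym (cong₂ (λ xs ys → sumℤ xs + sumℤ ys) (List.map-∘ Ss) (List.map-∘ Ss)) ⟩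
  sumSubsets n (f ∘ (false ∷_)) + sumSubsets n (f ∘ (true ∷_)) ∎
  where
  open ≡-Reasoning
  Ss = allSubsets n

sumSubsets-cong : ∀ n {f g : Subset n → ℤ} → (∀ S → f S ≡ g S) → sumSubsets n f ≡ sumSubsets n g
sumSubsets-cong n f≗g = cong sumℤ (List.map-cong f≗g (allSubsets n))

sumSubsets-+ : ∀ n (f g : Subset n → ℤ) →
               sumSubsets n (λ S → f S + g S) ≡ sumSubsets n f + sumSubsets n g
sumSubsets-+ n = sumℤ-map-+ (allSubsets n)

sumSubsets-*ʳ : ∀ n (f : Subset n → ℤ) (d : ℤ) →
                sumSubsets n (λ S → f S * d) ≡ sumSubsets n f * d
sumSubsets-*ʳ n = sumℤ-map-*ʳ (allSubsets n)

sumSubsets-const : ∀ n (c : ℤ) → sumSubsets n (λ _ → c) ≡ + (2 ^ n) * c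
sumSubsets-const zero    c = trans (ℤ.+-identityʳ c) (sym (ℤ.*-identityˡ c))
sumSubsets-const (suc n) c = begin
  sumSubsets (suc n) (λ _ → c)       ≡⟨ sumSubsets-suc n (λ _ → c) ⟩
  Σc + Σc                            ≡⟨ cong₂ _+_ (sumSubsets-const n c) (sumSubsets-const n c) ⟩
  + (2 ^ n) * c + + (2 ^ n) * c      ≡⟨ sym (ℤ.*-distribʳ-+ c (+ (2 ^ n)) (+ (2 ^ n))) ⟩
  + (2 ^ n ℕ.+ 2 ^ n) * c            ≡⟨ cong (λ m → + m * c) (sym (cong (ℕ._+_ (2 ^ n)) (ℕ.+-identityʳ (2 ^ n)))) ⟩
  + (2 ^ suc n) * c                  ∎
  where
  open ≡-Reasoning
  Σc = sumSubsets n (λ _ → c)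

sumSubsets-cases-*ʳ : ∀ m n (f : Subset (suc m) → ℤ) (g : Subset (suc n) → ℤ) (d : ℤ) →
  sumSubsets m (f ∘ (false ∷_)) ≡ sumSubsets n (g ∘ (false ∷_)) * d →
  sumSubsets m (f ∘ (true ∷_)) ≡ sumSubsets n (g ∘ (true ∷_)) * d →
  sumSubsets (suc m) f ≡ sumSubsets (suc n) g * d
sumSubsets-cases-*ʳ m n f g d eq₀ eq₁ = begin
  sumSubsets (suc m) f
    ≡⟨ sumSubsets-suc m f ⟩
  sumSubsets m (f ∘ (false ∷_)) + sumSubsets m (f ∘ (true ∷_))
    ≡⟨ cong₂ _+_ eq₀ eq₁ ⟩
  sumSubsets n (g ∘ (false ∷_)) * d + sumSubsets n (g ∘ (true ∷_)) * d
    ≡⟨ sym (ℤ.*-distribʳ-+ d (sumSubsets n (g ∘ (false ∷_))) (sumSubsets n (g ∘ (true ∷_)))) ⟩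
  (sumSubsets n (g ∘ (false ∷_)) + sumSubsets n (g ∘ (true ∷_))) * d
    ≡⟨ cong (_* d) (sym (sumSubsets-suc n g)) ⟩
  sumSubsets (suc n) g * d ∎
  where open ≡-Reasoning

boolToℤ : Bool → ℤ
boolToℤ false = + 0
boolToℤ true  = + 1

adjacentDiff : ∀ {k} → Fin k → Subset (suc k) → ℤ
adjacentDiff zero    (a ∷ b ∷ _) = boolToℤ a - boolToℤ b
adjacentDiff (suc i) (_ ∷ T)     = adjacentDiff i T

removeAdjacent : ∀ {A : Set} {k} → Fin (suc k) → Vec A (suc (suc k)) → Vec A k
removeAdjacent             zero    (_ ∷ _ ∷ xs) = xs
removeAdjacent {k = suc k} (suc i) (x ∷ xs)     = x ∷ removeAdjacent i xs

agreementKernel : ∀ {n} → (ℕ → ℕ → ℤ) → Subset n → Subset n → ℤ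
agreementKernel f S T = f ∣ S ∩ T ∣ ∣ ∁ S ∩ ∁ T ∣

Δ : (ℕ → ℕ → ℤ) → ℕ → ℕ → ℤ
Δ f a b = f (suc a) (suc b) - f a b

sumSubsets-*-adjacentDiff-zero : ∀ k (h : Subset (suc (suc k)) → ℤ) →
  sumSubsets (suc (suc k)) (λ T → h T * adjacentDiff zero T)
  ≡ sumSubsets k (λ T → h (true ∷ false ∷ T) - h (false ∷ true ∷ T))
sumSubsets-*-adjacentDiff-zero k h = begin
  sumSubsets (suc (suc k)) (λ T → h T * adjacentDiff zero T)
    ≡⟨ sumSubsets-suc (suc k) _ ⟩
  _ ≡⟨ cong₂ _+_ (sumSubsets-suc k _) (sumSubsets-suc k _) ⟩
  (∑ (λ T → h (false ∷ false ∷ T) * (+ 0 - + 0)) + ∑ (λ T → h (false ∷ true ∷ T) * (+ 0 - + 1)))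
  + (∑ (λ T → h (true ∷ false ∷ T) * (+ 1 - + 0)) + ∑ (λ T → h (true ∷ true ∷ T) * (+ 1 - + 1)))
    ≡⟨ sym (cong₂ _+_ (sumSubsets-+ k _ _) (sumSubsets-+ k _ _)) ⟩
  _ ≡⟨ sym (sumSubsets-+ k _ _) ⟩
  _ ≡⟨ sumSubsets-cong k (λ T → collapse (h (false ∷ false ∷ T)) (h (false ∷ true ∷ T))
                                         (h (true ∷ false ∷ T)) (h (true ∷ true ∷ T))) ⟩
  sumSubsets k (λ T → h (true ∷ false ∷ T) - h (false ∷ true ∷ T)) ∎
  where
  open ≡-Reasoning
  ∑ = sumSubsets k
  collapse : ∀ w x y z → (w * (+ 0 - + 0) + x * (+ 0 - + 1)) + (y * (+ 1 - + 0) + z * (+ 1 - + 1))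
                         ≡ y - x
  collapse = solve-∀

agreementKernel-swap : ∀ {k} f s₀ s₁ (S T : Subset k) →
  agreementKernel f (s₀ ∷ s₁ ∷ S) (true ∷ false ∷ T) - agreementKernel f (s₀ ∷ s₁ ∷ S) (false ∷ true ∷ T)
  ≡ agreementKernel (Δ f) S T * adjacentDiff zero (s₀ ∷ s₁ ∷ S)
agreementKernel-swap f true  false S T = sym (ℤ.*-identityʳ _)
agreementKernel-swap f false true  S T = negateDiff (f _ _) (f _ _)
  where
  negateDiff : ∀ x y → x - y ≡ (y - x) * (+ 0 - + 1)
  negateDiff = solve-∀
agreementKernel-swap f true  true  S T = trans (ℤ.+-inverseʳ (f _ _)) (sym (ℤ.*-zeroʳ (Δ f _ _)))
agreementKernel-swap f false false S T = trans (ℤ.+-inverseʳ (f _ _)) (sym (ℤ.*-zeroʳ (Δ f _ _)))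

-- Passing a coordinate where S and T agree shifts one of the two counts, so the
-- induction has to range over all kernels f.
agreementKernel-adjacentDiff : ∀ {k} (f : ℕ → ℕ → ℤ) (S : Subset (suc (suc k))) (i : Fin (suc k)) →
  sumSubsets (suc (suc k)) (λ T → agreementKernel f S T * adjacentDiff i T)
  ≡ sumSubsets k (agreementKernel (Δ f) (removeAdjacent i S)) * adjacentDiff i S
agreementKernel-adjacentDiff {k} f (s₀ ∷ s₁ ∷ S) zero = begin
  sumSubsets (suc (suc k)) (λ T → agreementKernel f (s₀ ∷ s₁ ∷ S) T * adjacentDiff zero T)
    ≡⟨ sumSubsets-*-adjacentDiff-zero k (agreementKernel f (s₀ ∷ s₁ ∷ S)) ⟩
  _ ≡⟨ sumSubsets-cong k (agreementKernel-swap f s₀ s₁ S) ⟩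
  _ ≡⟨ sumSubsets-*ʳ k (agreementKernel (Δ f) S) _ ⟩
  sumSubsets k (agreementKernel (Δ f) S) * adjacentDiff zero (s₀ ∷ s₁ ∷ S) ∎
  where open ≡-Reasoning
agreementKernel-adjacentDiff {suc k} f (true ∷ S) (suc i) =
  sumSubsets-cases-*ʳ (suc (suc k)) k _ _ _
    (agreementKernel-adjacentDiff f S i)
    (agreementKernel-adjacentDiff (λ a → f (suc a)) S i)
agreementKernel-adjacentDiff {suc k} f (false ∷ S) (suc i) =
  sumSubsets-cases-*ʳ (suc (suc k)) k _ _ _
    (agreementKernel-adjacentDiff (λ a b → f a (suc b)) S i)
    (agreementKernel-adjacentDiff f S i)

pairCount : ℕ → ℕ → ℤ
pairCount a b = + (a C 2) + + (b C 2)

agreementCount : ℕ → ℕ → ℤ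
agreementCount a b = + (a ℕ.+ b)

suc-C-2 : ∀ n → suc n C 2 ≡ n ℕ.+ n C 2
suc-C-2 n = begin
  suc n C 2         ≡⟨ sym (nCk+nC[k+1]≡[n+1]C[k+1] n 1) ⟩
  n C 1 ℕ.+ n C 2   ≡⟨ cong (ℕ._+ n C 2) (nC1≡n n) ⟩
  n ℕ.+ n C 2       ∎
  where open ≡-Reasoning

Δ-pairCount : ∀ a b → Δ pairCount a b ≡ agreementCount a b
Δ-pairCount a b = begin
  + (suc a C 2) + + (suc b C 2) - pairCount a b
    ≡⟨ cong₂ (λ x y → + x + + y - pairCount a b) (suc-C-2 a) (suc-C-2 b) ⟩
  (+ a + + (a C 2)) + (+ b + + (b C 2)) - (+ (a C 2) + + (b C 2))
    ≡⟨ cancel (+ a) (+ b) (+ (a C 2)) (+ (b C 2)) ⟩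
  + a + + b ∎
  where
  open ≡-Reasoning
  cancel : ∀ a b x y → (a + x) + (b + y) - (x + y) ≡ a + b
  cancel = solve-∀

sumSubsets-agreementCount : ∀ n (S : Subset (suc n)) →
  sumSubsets (suc n) (agreementKernel agreementCount S) ≡ + (suc n ℕ.* 2 ^ n)
sumSubsets-agreementCount zero    (true  ∷ []) = refl
sumSubsets-agreementCount zero    (false ∷ []) = refl
sumSubsets-agreementCount (suc n) (s ∷ S) = begin
  sumSubsets (suc (suc n)) (agreementKernel agreementCount (s ∷ S))
    ≡⟨ sumSubsets-suc (suc n) _ ⟩
  sumSubsets (suc n) (agreementKernel agreementCount (s ∷ S) ∘ (false ∷_))
  + sumSubsets (suc n) (agreementKernel agreementCount (s ∷ S) ∘ (true ∷_))
    ≡⟨ halves s ⟩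
  Σ′ + (+ (2 ^ suc n) * + 1 + Σ′)
    ≡⟨ cong (λ x → Σ′ + (x + Σ′)) (ℤ.*-identityʳ (+ (2 ^ suc n))) ⟩
  Σ′ + (+ (2 ^ suc n) + Σ′)
    ≡⟨ cong (λ x → x + (+ (2 ^ suc n) + x)) (sumSubsets-agreementCount n S) ⟩
  + (N ℕ.+ (2 ^ suc n ℕ.+ N))
    ≡⟨ cong +_ (arith n (2 ^ n)) ⟩
  + (suc (suc n) ℕ.* 2 ^ suc n) ∎
  where
  open ≡-Reasoning
  Σ′ = sumSubsets (suc n) (agreementKernel agreementCount S)
  N = suc n ℕ.* 2 ^ n
  oneMore : sumSubsets (suc n) (λ T → + 1 + agreementKernel agreementCount S T)
            ≡ + (2 ^ suc n) * + 1 + Σ′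
  oneMore = trans (sumSubsets-+ (suc n) _ _) (cong (_+ Σ′) (sumSubsets-const (suc n) (+ 1)))
  halves : ∀ s →
    sumSubsets (suc n) (agreementKernel agreementCount (s ∷ S) ∘ (false ∷_))
    + sumSubsets (suc n) (agreementKernel agreementCount (s ∷ S) ∘ (true ∷_))
    ≡ Σ′ + (+ (2 ^ suc n) * + 1 + Σ′)
  halves true  = cong (_+_ Σ′) oneMore
  halves false = trans (ℤ.+-comm _ Σ′) (cong (_+_ Σ′) (trans (sumSubsets-cong (suc n)
                   (λ T → cong +_ (ℕ.+-suc ∣ S ∩ T ∣ _))) oneMore))
  arith : ∀ n p → suc n ℕ.* p ℕ.+ (2 ℕ.* p ℕ.+ suc n ℕ.* p) ≡ suc (suc n) ℕ.* (2 ℕ.* p)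
  arith = ℕ-Solver.solve-∀

adjacentDiff-eigenvector : ∀ n (i : Fin (suc (suc n))) →
  InEigenspace (3 ℕ.+ n) (eigval (3 ℕ.+ n)) (adjacentDiff i)
adjacentDiff-eigenvector n i S = begin
  Mmul (3 ℕ.+ n) (adjacentDiff i) S
    ≡⟨ agreementKernel-adjacentDiff pairCount S i ⟩
  sumSubsets (suc n) (agreementKernel (Δ pairCount) R) * d
    ≡⟨ cong (_* d) (sumSubsets-cong (suc n) (λ T → Δ-pairCount ∣ R ∩ T ∣ ∣ ∁ R ∩ ∁ T ∣)) ⟩
  sumSubsets (suc n) (agreementKernel agreementCount R) * d
    ≡⟨ cong (_* d) (sumSubsets-agreementCount n R) ⟩
  + (suc n ℕ.* 2 ^ n) * d
    ≡⟨ cong (λ m → + m * d) (ℕ.*-comm (suc n) (2 ^ n)) ⟩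
  eigval (3 ℕ.+ n) * d ∎
  where
  open ≡-Reasoning
  R = removeAdjacent i S
  d = adjacentDiff i S

initialSegment : ∀ {k} → Fin k → Subset (suc k)
initialSegment zero    = true ∷ ⊥
initialSegment (suc i) = true ∷ initialSegment i

adjacentDiff-⊥ : ∀ {k} (l : Fin k) → adjacentDiff l ⊥ ≡ 0ℤ
adjacentDiff-⊥ zero    = refl
adjacentDiff-⊥ (suc l) = adjacentDiff-⊥ l

sumFin-suc : ∀ k (f : Fin (suc k) → ℤ) → sumFin (suc k) f ≡ f zero + sumFin k (f ∘ suc)
sumFin-suc k f = cong (λ xs → f zero + sumℤ xs)
  (trans (List.map-tabulate suc f) (sym (List.map-tabulate (λ l → l) (f ∘ suc))))

sumFin-zero : ∀ k (f : Fin k → ℤ) → (∀ l → f l ≡ 0ℤ) → sumFin k f ≡ 0ℤ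
sumFin-zero zero    f f≡0 = refl
sumFin-zero (suc k) f f≡0 =
  trans (sumFin-suc k f) (cong₂ _+_ (f≡0 zero) (sumFin-zero k (f ∘ suc) (f≡0 ∘ suc)))

sumFin-*-adjacentDiff-initialSegment : ∀ k (c : Fin k → ℤ) (i : Fin k) →
  sumFin k (λ l → c l * adjacentDiff l (initialSegment i)) ≡ c i
sumFin-*-adjacentDiff-initialSegment (suc k) c zero = begin
  sumFin (suc k) (λ l → c l * adjacentDiff l (true ∷ ⊥))
    ≡⟨ sumFin-suc k (λ l → c l * adjacentDiff l (true ∷ ⊥)) ⟩
  c zero * + 1 + sumFin k (λ l → c (suc l) * adjacentDiff l ⊥)
    ≡⟨ cong₂ _+_ (ℤ.*-identityʳ (c zero))
                 (sumFin-zero k _ (λ l → trans (cong (c (suc l) *_) (adjacentDiff-⊥ l))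
                                               (ℤ.*-zeroʳ (c (suc l))))) ⟩
  c zero + 0ℤ
    ≡⟨ ℤ.+-identityʳ (c zero) ⟩
  c zero ∎
  where open ≡-Reasoning
sumFin-*-adjacentDiff-initialSegment (suc k) c (suc i) = begin
  sumFin (suc k) (λ l → c l * adjacentDiff l (true ∷ initialSegment i))
    ≡⟨ sumFin-suc k (λ l → c l * adjacentDiff l (true ∷ initialSegment i)) ⟩
  c zero * adjacentDiff zero (true ∷ initialSegment i) + sumFin k (λ l → c (suc l) * adjacentDiff l (initialSegment i))
    ≡⟨ cong₂ _+_ (trans (cong (c zero *_) (startsInside i)) (ℤ.*-zeroʳ (c zero)))
                 (sumFin-*-adjacentDiff-initialSegment k (c ∘ suc) i) ⟩
  0ℤ + c (suc i)
    ≡⟨ ℤ.+-identityˡ (c (suc i)) ⟩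
  c (suc i) ∎
  where
  open ≡-Reasoning
  startsInside : ∀ {k} (j : Fin k) → adjacentDiff zero (true ∷ initialSegment j) ≡ 0ℤ
  startsInside zero    = refl
  startsInside (suc j) = refl

adjacentDiff-linearlyIndependent : ∀ k → LinIndep (suc k) k adjacentDiff
adjacentDiff-linearlyIndependent k c combination≡0 i =
  trans (sym (sumFin-*-adjacentDiff-initialSegment k c i)) (combination≡0 (initialSegment i))

mainTheorem14 : (r : ℕ) → 4 ≤ r →
    Σ (Fin (r ∸ 1) → Subset r → ℤ) λ vs →
      (∀ i → InEigenspace r (eigval r) (vs i)) × LinIndep r (r ∸ 1) vs
mainTheorem14 (suc (suc (suc (suc j)))) (s≤s (s≤s (s≤s (s≤s _)))) =
  adjacentDiff , adjacentDiff-eigenvector (suc j) , adjacentDiff-linearlyIndependent (3 ℕ.+ j)
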